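{- Let $(G,\beta)$ be an edge-labeled graph (in the setting described in the context) with vertices $v_1,\dots,v_n$, and let $v_i$ be a vertex adjacent to $v_{i_1},\dots,v_{i_s}$ via edges $v_iv_{i_t}$ labeled by $r_t$, $t=1,\dots,s$. Let $(G_{red},\beta_{red})$ be the reduced graph of $(G,\beta)$ associated to $v_i$. Then the map $\psi:\hat R_G\to\hat R_{G_{red}}$, $(f_{v_1},\dots,f_{v_i},\dots,f_{v_n})\mapsto(f_{v_1},\dots,\widehat{f_{v_i}},\dots,f_{v_n})$ (the $i$-th coordinate removed) is a surjective $\mathbb{Z}$-module homomorphism.
   Context: Setting: $G$ is a finite connected simple graph. Each vertex $v$ is labeled by $M_v=m_v\mathbb{Z}$ ($m_v\in\mathbb{Z}$), each edge $e$ by $\mathbb{Z}/r_e\mathbb{Z}$ ($r_e\in\mathbb{Z}$). A spline is $f\in\prod_v M_v$ with $f_u-f_v\in r_e\mathbb{Z}$ for every edge $e=uv$; $\hat R_G$ is the $\mathbb{Z}$-module of splines. $(a,b,\dots)$ denotes gcd and $[a,b,\dots]$ lcm. Reduced graph associated to a vertex $v$: (1) vertex reduction: delete $v$ and all edges incident to $v$; each neighbor $w$ of $v$ is kept but its vertex module is replaced by $[m_w,(m_v,r_{vw})]\mathbb{Z}$; for every pair of distinct neighbors $w,w'$ of $v$ add a new edge $ww'$ labeled $(r_{vw},r_{vw'})$; (2) multiple edge reduction: whenever the resulting graph has several edges between two vertices, with labels $r_1,\dots,r_k$, replace them by a single edge labeled $[r_1,\dots,r_k]$. The result is a simple edge-labeled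 graph, denoted $(G_{red},\beta_{red})$. -}

module Defs where

open import Data.Nat using (ℕ; suc)
open import Data.Fin using (Fin; punchIn)
open import Data.Fin.Properties using () renaming (_≟_ to _≟ᶠ_)
open import Data.Bool using (Bool; true; false; if_then_else_; _∨_; _∧_; not)
open import Data.Integer using (ℤ; _+_; _-_; _*_)
open import Data.Integer.Divisibility using (_∣_)
open import Data.Integer.GCD using (gcd)
open import Data.Integer.LCM using (lcm)
open import Relation.Nullary.Decidable using (⌊_⌋)
open import Relation.Binary.PropositionalEquality using (_≡_)
open import Data.Product using (_×_)

-- An edge-labeled graph on the vertex set Fin n.
--   adj u v = true  iff  uv is an edge,
--   m v         : generator of the vertex module M_v = m_v ℤ,
--   r u v       : label r_e of the edge e = uv (edge module ℤ / r_e ℤ);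
--                 only meaningful when adj u v ≡ true.
record LabeledGraph (n : ℕ) : Set where
  field
    adj : Fin n → Fin n → Bool
    m   : Fin n → ℤ
    r   : Fin n → Fin n → ℤ
open LabeledGraph public

record IsSimple {n : ℕ} (G : LabeledGraph n) : Set where
  field
    adj-sym    : ∀ u v → adj G u v ≡ adj G v u
    adj-irrefl : ∀ v → adj G v v ≡ false
    r-sym      : ∀ u v → adj G u v ≡ true → r G u v ≡ r G v u

data Reachable {n : ℕ} (G : LabeledGraph n) : Fin n → Fin n → Set where
  here : ∀ {u} → Reachable G u u
  step : ∀ {u w v} → adj G u w ≡ true → Reachable G w v → Reachable G u v

Connected : {n : ℕ} → LabeledGraph n → Set
Connected G = ∀ u v → Reachable G u v

IsSpline : {n : ℕ} → LabeledGraph n → (Fin n → ℤ) → Set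
IsSpline {n} G f =
  ((v : Fin n) → m G v ∣ f v) × ((u v : Fin n) → adj G u v ≡ true → r G u v ∣ (f u - f v))

-- Reduced graph associated to the vertex i of a graph on Fin (suc n).
-- The remaining vertices are indexed by Fin n via  punchIn i.
module _ {n : ℕ} (G : LabeledGraph (suc n)) (i : Fin (suc n)) where
  private
    pI : Fin n → Fin (suc n)
    pI = punchIn i
    nb : Fin n → Bool
    nb w = adj G i (pI w)
    new : Fin n → Fin n → Bool
    new w w' = nb w ∧ nb w' ∧ not ⌊ w ≟ᶠ w' ⌋
    old : Fin n → Fin n → Bool
    old w w' = adj G (pI w) (pI w')

  reduce : LabeledGraph n
  reduce = record
    { adj = λ w w' → old w w' ∨ new w w'
    ; m   = λ w → if nb w then lcm (m G (pI w)) (gcd (m G i) (r G i (pI w)))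
                          else m G (pI w)
    ; r   = λ w w' → if old w w'
                       then (if new w w'
                               then lcm (r G (pI w) (pI w')) (gcd (r G i (pI w)) (r G i (pI w')))
                               else r G (pI w) (pI w'))
                       else (if new w w'
                               then gcd (r G i (pI w)) (r G i (pI w'))
                               else r G (pI w) (pI w'))
    }

ψ : {n : ℕ} → Fin (suc n) → (Fin (suc n) → ℤ) → (Fin n → ℤ)
ψ i f w = f (punchIn i w)

module Submission where

-- Deleting a coordinate preserves the vertex and edge conditions of the reduced graph: a
-- neighbour w of v satisfies f w ≡ f v (mod r_vw) and f v ≡ 0 (mod m_v), hence
-- f w ≡ 0 (mod (m_v, r_vw)), and two neighbours w, w' satisfy f w ≡ f w' (mod (r_vw, r_vw')).
-- Conversely, a spline g on the reduced graph extends to G once we find f v with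
-- f v ≡ 0 (mod m_v) and f v ≡ g w (mod r_vw) for every neighbour w.  These congruences are
-- pairwise compatible exactly because of the labels of the reduced graph, so the generalised
-- Chinese remainder theorem solves them; its induction step merges two moduli into their lcm
-- and rests on the divisibility  (lcm(a,b), c) ∣ t  whenever  (a,c) ∣ t  and  (b,c) ∣ t.

open import Defs
open import Data.Nat using (ℕ; suc)
import Data.Nat as ℕ
import Data.Nat.Properties as ℕ
import Data.Nat.GCD as ℕ
import Data.Nat.LCM as ℕ
import Data.Nat.Divisibility as ℕ
open import Data.Integer using (ℤ; _+_; _*_; _-_; -_; +_; ∣_∣; 0ℤ; 1ℤ; +[1+_])
open import Data.Integer.Properties using (pos-+; pos-*; abs-*; +-comm; *-comm; +-inverseʳ; +-identityʳ)
import Data.Integer.Divisibility as Unsigned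
open import Data.Integer.Divisibility.Signed
  using (_∣_; divides; ∣ᵤ⇒∣; ∣⇒∣ᵤ; ∣-refl; ∣-trans; m∣∣m∣; ∣m∣n⇒∣m+n; ∣m⇒∣-m;
         ∣n⇒∣m*n; ∣m⇒∣m*n; *-monoˡ-∣; *-monoʳ-∣; *-cancelʳ-∣)
open import Data.Integer.GCD using (gcd; gcd[i,j]∣i; gcd[i,j]∣j; gcd[i,j]≡0⇒i≡0)
open import Data.Integer.LCM using (lcm; i∣lcm[i,j]; j∣lcm[i,j]; lcm-least; lcm[0,i]≡0)
open import Data.Integer.Tactic.RingSolver using (solve-∀)
open import Data.Fin using (Fin; zero; suc; punchIn; punchOut)
open import Data.Fin.Properties using (punchIn-punchOut) renaming (_≟_ to _≟ᶠ_)
open import Data.Vec.Functional using (insertAt)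
open import Data.Vec.Functional.Properties using (insertAt-lookup; insertAt-punchIn)
open import Data.Bool using (true; false; if_then_else_)
open import Data.Product using (Σ; ∃; ∃₂; _×_; _,_; proj₁; proj₂)
open import Data.Empty using (⊥-elim)
open import Function using (_∘_)
open import Relation.Nullary using (yes; no)
open import Relation.Binary.PropositionalEquality using (_≡_; _≢_; refl; sym; trans; cong; cong₂; subst; module ≡-Reasoning)

open ≡-Reasoning

gcd∣ˡ : ∀ a b → gcd a b ∣ a
gcd∣ˡ a b = ∣ᵤ⇒∣ (gcd[i,j]∣i a b)

gcd∣ʳ : ∀ a b → gcd a b ∣ b
gcd∣ʳ a b = ∣ᵤ⇒∣ (gcd[i,j]∣j a b)

∣lcmˡ : ∀ a b → a ∣ lcm a b
∣lcmˡ a b = ∣ᵤ⇒∣ (i∣lcm[i,j] a b)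

∣lcmʳ : ∀ a b → b ∣ lcm a b
∣lcmʳ a b = ∣ᵤ⇒∣ (j∣lcm[i,j] a b)

lcm-least′ : ∀ {a b c} → a ∣ c → b ∣ c → lcm a b ∣ c
lcm-least′ {a} {b} {c} a∣c b∣c = ∣ᵤ⇒∣ (lcm-least {a} {b} {c} (∣⇒∣ᵤ a∣c) (∣⇒∣ᵤ b∣c))

*-pres-∣ : ∀ {a b c d} → a ∣ b → c ∣ d → a * c ∣ b * d
*-pres-∣ {b = b} {c} a∣b c∣d = ∣-trans (*-monoˡ-∣ c a∣b) (*-monoʳ-∣ b c∣d)

lcm*gcd∣* : ∀ a b → lcm a b * gcd a b ∣ a * b
lcm*gcd∣* a b = ∣ᵤ⇒∣ (ℕ.∣-reflexive
  (trans (abs-* (lcm a b) (gcd a b))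
  (trans (ℕ.*-comm (ℕ.lcm ∣ a ∣ ∣ b ∣) (ℕ.gcd ∣ a ∣ ∣ b ∣))
  (trans (ℕ.gcd*lcm ∣ a ∣ ∣ b ∣) (sym (abs-* a b))))))

infix 4 _≡_mod_

record _≡_mod_ (x y m : ℤ) : Set where
  constructor congruent
  field divides-diff : m ∣ x - y
open _≡_mod_

mod-refl : ∀ {m x} → x ≡ x mod m
mod-refl {x = x} = congruent (divides 0ℤ (+-inverseʳ x))

mod-sym : ∀ {m x y} → x ≡ y mod m → y ≡ x mod m
mod-sym {m} {x} {y} (congruent m∣x-y) = congruent (subst (m ∣_) (negate-diff x y) (∣m⇒∣-m m∣x-y))
  where
  negate-diff : ∀ x y → - (x - y) ≡ y - x
  negate-diff = solve-∀

mod-trans : ∀ {m x y z} → x ≡ y mod m → y ≡ z mod m → x ≡ z mod m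
mod-trans {m} {x} {y} {z} (congruent m∣x-y) (congruent m∣y-z) =
  congruent (subst (m ∣_) (telescope x y z) (∣m∣n⇒∣m+n m∣x-y m∣y-z))
  where
  telescope : ∀ x y z → (x - y) + (y - z) ≡ x - z
  telescope = solve-∀

mod-resp : ∀ {m x x′ y y′} → x ≡ x′ → y ≡ y′ → x ≡ y mod m → x′ ≡ y′ mod m
mod-resp refl refl x≡y = x≡y

mod-weaken : ∀ {d m x y} → d ∣ m → x ≡ y mod m → x ≡ y mod d
mod-weaken d∣m (congruent m∣x-y) = congruent (∣-trans d∣m m∣x-y)

mod-trans-gcd : ∀ {a b x y z} → x ≡ y mod a → y ≡ z mod b → x ≡ z mod gcd a b
mod-trans-gcd {a} {b} x≡y y≡z = mod-trans (mod-weaken (gcd∣ˡ a b) x≡y) (mod-weaken (gcd∣ʳ a b) y≡z)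

mod-one : ∀ {x y} → x ≡ y mod 1ℤ
mod-one = congruent (∣ᵤ⇒∣ (ℕ.1∣ _))

∣⇒≡0-mod : ∀ {m x} → m ∣ x → x ≡ 0ℤ mod m
∣⇒≡0-mod {m} {x} m∣x = congruent (subst (m ∣_) (sym (+-identityʳ x)) m∣x)

≡0-mod⇒∣ : ∀ {m x} → x ≡ 0ℤ mod m → m ∣ x
≡0-mod⇒∣ {m} {x} (congruent m∣x-0) = subst (m ∣_) (+-identityʳ x) m∣x-0

-- ℕ's extended Euclid gives d + y ∣b∣ = x ∣a∣ (or the symmetric form); multiplying by the
-- signs of a and b turns it into a ℤ-combination of a and b.
combination-from-ℕ : ∀ {d x y} a b → d ℕ.+ y ℕ.* ∣ b ∣ ≡ x ℕ.* ∣ a ∣ →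
                     ∃₂ λ u v → + d ≡ a * u + b * v
combination-from-ℕ {d} {x} {y} a b eq with m∣∣m∣ {a} | m∣∣m∣ {b}
... | divides s ∣a∣≡sa | divides t ∣b∣≡tb = + x * s , - (+ y * t) , (begin
  + d                                    ≡⟨ isolate (+ d) (+ y * + ∣ b ∣) ⟩
  (+ d + + y * + ∣ b ∣) - + y * + ∣ b ∣  ≡⟨ cong (_- + y * + ∣ b ∣) eqℤ ⟩
  + x * + ∣ a ∣ - + y * + ∣ b ∣          ≡⟨ cong₂ (λ p q → + x * p - + y * q) ∣a∣≡sa ∣b∣≡tb ⟩
  + x * (s * a) - + y * (t * b)          ≡⟨ regroup (+ x) (+ y) a b s t ⟩
  a * (+ x * s) + b * - (+ y * t)        ∎)
  where
  eqℤ : + d + + y * + ∣ b ∣ ≡ + x * + ∣ a ∣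
  eqℤ = trans (cong (λ z → + d + z) (sym (pos-* y ∣ b ∣)))
        (trans (sym (pos-+ d (y ℕ.* ∣ b ∣))) (trans (cong +_ eq) (pos-* x ∣ a ∣)))
  isolate : ∀ p q → p ≡ (p + q) - q
  isolate = solve-∀
  regroup : ∀ x y a b s t → x * (s * a) - y * (t * b) ≡ a * (x * s) + b * - (y * t)
  regroup = solve-∀

gcd-bézout : ∀ a b → ∃₂ λ u v → gcd a b ≡ a * u + b * v
gcd-bézout a b with ℕ.Bézout.identity (ℕ.gcd-GCD ∣ a ∣ ∣ b ∣)
... | ℕ.Bézout.+- x y eq = combination-from-ℕ {x = x} {y = y} a b eq
... | ℕ.Bézout.-+ x y eq with combination-from-ℕ {x = y} {y = x} b a eq
...   | u , v , d≡bu+av = v , u , trans d≡bu+av (+-comm (b * u) (a * v))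

∣*-of-gcd-multiple : ∀ {d t} a b c → d ∣ a * b → d ∣ c * a → gcd b c ∣ t → d ∣ t * a
∣*-of-gcd-multiple {d} a b c d∣ab d∣ca (divides k refl) with gcd-bézout b c
... | u , v , g≡bu+cv = subst (d ∣_) (sym expand) (∣m∣n⇒∣m+n (∣n⇒∣m*n (k * u) d∣ab) (∣n⇒∣m*n (k * v) d∣ca))
  where
  regroup : ∀ k a b c u v → k * (b * u + c * v) * a ≡ k * u * (a * b) + k * v * (c * a)
  regroup = solve-∀
  expand : k * gcd b c * a ≡ k * u * (a * b) + k * v * (c * a)
  expand = trans (cong (λ g → k * g * a) g≡bu+cv) (regroup k a b c u v)

-- The nonzero case multiplies through by D = gcd a b = a p + b q, so that
-- t D = (t a) p + (t b) q, and each summand is divisible by e D, where e = gcd (lcm a b) c.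
gcd[lcm,c]∣ : ∀ a b c {t} → gcd a c ∣ t → gcd b c ∣ t → gcd (lcm a b) c ∣ t
gcd[lcm,c]∣ a b c {t} a,c∣t b,c∣t with gcd a b in gcd≡D
... | + 0 = subst (λ l → gcd l c ∣ t) (sym lcm≡0) (subst (λ a′ → gcd a′ c ∣ t) a≡0 a,c∣t)
  where
  a≡0 : a ≡ 0ℤ
  a≡0 = gcd[i,j]≡0⇒i≡0 a b gcd≡D
  lcm≡0 : lcm a b ≡ 0ℤ
  lcm≡0 = trans (cong (λ a′ → lcm a′ b) a≡0) (lcm[0,i]≡0 b)
... | D@(+[1+ _ ]) with gcd-bézout a b
...   | p , q , gcd≡ap+bq =
  *-cancelʳ-∣ D (subst (e * D ∣_) (sym tD≡) (∣m∣n⇒∣m+n (∣m⇒∣m*n p eD∣ta) (∣m⇒∣m*n q eD∣tb)))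
  where
  e : ℤ
  e = gcd (lcm a b) c
  eD∣ab : e * D ∣ a * b
  eD∣ab = ∣-trans (*-monoˡ-∣ D (gcd∣ˡ (lcm a b) c))
                  (subst (λ g → lcm a b * g ∣ a * b) gcd≡D (lcm*gcd∣* a b))
  D∣a : D ∣ a
  D∣a = subst (_∣ a) gcd≡D (gcd∣ˡ a b)
  D∣b : D ∣ b
  D∣b = subst (_∣ b) gcd≡D (gcd∣ʳ a b)
  eD∣ta : e * D ∣ t * a
  eD∣ta = ∣*-of-gcd-multiple a b c eD∣ab (*-pres-∣ (gcd∣ʳ (lcm a b) c) D∣a) b,c∣t
  eD∣tb : e * D ∣ t * b
  eD∣tb = ∣*-of-gcd-multiple b a c (subst (e * D ∣_) (*-comm a b) eD∣ab)
                             (*-pres-∣ (gcd∣ʳ (lcm a b) c) D∣b) a,c∣t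
  distribute : ∀ t a b p q → t * (a * p + b * q) ≡ t * a * p + t * b * q
  distribute = solve-∀
  tD≡ : t * D ≡ t * a * p + t * b * q
  tD≡ = trans (cong (t *_) (trans (sym gcd≡D) gcd≡ap+bq)) (distribute t a b p q)

crt-pair : ∀ M R {a b} → a ≡ b mod gcd M R → ∃ λ y → y ≡ a mod M × y ≡ b mod R
crt-pair M R {a} {b} (congruent (divides k a-b≡kg)) with gcd-bézout M R
... | u , v , g≡Mu+Rv =
  a - M * (u * k) , congruent (divides (- (u * k)) (shift a M (u * k))) , congruent (divides (k * v) (begin
    a - M * (u * k) - b          ≡⟨ reorder a b M (u * k) ⟩
    (a - b) - M * (u * k)        ≡⟨ cong (_- M * (u * k)) (trans a-b≡kg (cong (k *_) g≡Mu+Rv)) ⟩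
    k * (M * u + R * v) - M * (u * k) ≡⟨ cancel k M R u v ⟩
    k * v * R                    ∎))
  where
  shift : ∀ a M w → a - M * w - a ≡ - w * M
  shift = solve-∀
  reorder : ∀ a b M w → a - M * w - b ≡ (a - b) - M * w
  reorder = solve-∀
  cancel : ∀ k M R u v → k * (M * u + R * v) - M * (u * k) ≡ k * v * R
  cancel = solve-∀

merge-compatible : ∀ M R S {y a b c} → y ≡ a mod M → y ≡ b mod R →
                   a ≡ c mod gcd M S → b ≡ c mod gcd R S → y ≡ c mod gcd (lcm M R) S
merge-compatible M R S y≡a y≡b a≡c b≡c = congruent (gcd[lcm,c]∣ M R S
  (divides-diff (mod-trans (mod-weaken (gcd∣ˡ M S) y≡a) a≡c))
  (divides-diff (mod-trans (mod-weaken (gcd∣ˡ R S) y≡b) b≡c)))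

crt : ∀ {k} M₀ a₀ (M a : Fin k → ℤ) →
      (∀ j → a₀ ≡ a j mod gcd M₀ (M j)) →
      (∀ j l → a j ≡ a l mod gcd (M j) (M l)) →
      ∃ λ x → x ≡ a₀ mod M₀ × ∀ j → x ≡ a j mod M j
crt {ℕ.zero} M₀ a₀ M a _ _ = a₀ , mod-refl , λ ()
crt {suc k} M₀ a₀ M a compat₀ compat =
  let y , y≡a₀ , y≡a₁ = crt-pair M₀ (M zero) (compat₀ zero)
      x , x≡y , x≡aⱼ  = crt (lcm M₀ (M zero)) y (M ∘ suc) (a ∘ suc)
        (λ j → merge-compatible M₀ (M zero) (M (suc j)) y≡a₀ y≡a₁ (compat₀ (suc j)) (compat zero (suc j)))
        (λ j l → compat (suc j) (suc l))
  in x , mod-trans (mod-weaken (∣lcmˡ M₀ (M zero)) x≡y) y≡a₀ , λ where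
       zero    → mod-trans (mod-weaken (∣lcmʳ M₀ (M zero)) x≡y) y≡a₁
       (suc j) → x≡aⱼ j

data PunchView {n : ℕ} (i : Fin (suc n)) : Fin (suc n) → Set where
  pivot   : PunchView i i
  punched : (w : Fin n) → PunchView i (punchIn i w)

punchView : ∀ {n} (i v : Fin (suc n)) → PunchView i v
punchView i v with i ≟ᶠ v
... | yes refl = pivot
... | no i≢v   = subst (PunchView i) (punchIn-punchOut i≢v) (punched (punchOut i≢v))

module _ {n : ℕ} (G : LabeledGraph (suc n)) (i : Fin (suc n)) where

  private
    ↑ : Fin n → Fin (suc n)
    ↑ = punchIn i

    Gᵣ : LabeledGraph n
    Gᵣ = reduce G i

  reduce-m-least : ∀ w {x} → m G (↑ w) ∣ x →
                   (adj G i (↑ w) ≡ true → gcd (m G i) (r G i (↑ w)) ∣ x) → m Gᵣ w ∣ x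
  reduce-m-least w m∣x gcd∣x with adj G i (↑ w)
  ... | true  = lcm-least′ m∣x (gcd∣x refl)
  ... | false = m∣x

  m∣reduce-m : ∀ w → m G (↑ w) ∣ m Gᵣ w
  m∣reduce-m w with adj G i (↑ w)
  ... | true  = ∣lcmˡ (m G (↑ w)) (gcd (m G i) (r G i (↑ w)))
  ... | false = ∣-refl

  gcd∣reduce-m : ∀ w → adj G i (↑ w) ≡ true → gcd (m G i) (r G i (↑ w)) ∣ m Gᵣ w
  gcd∣reduce-m w e rewrite e = ∣lcmʳ (m G (↑ w)) (gcd (m G i) (r G i (↑ w)))

  reduce-r-least : ∀ w w′ {x} → adj Gᵣ w w′ ≡ true →
    (adj G (↑ w) (↑ w′) ≡ true → r G (↑ w) (↑ w′) ∣ x) →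
    (adj G i (↑ w) ≡ true → adj G i (↑ w′) ≡ true → w ≢ w′ → gcd (r G i (↑ w)) (r G i (↑ w′)) ∣ x) →
    r Gᵣ w w′ ∣ x
  reduce-r-least w w′ e old new with adj G (↑ w) (↑ w′) | adj G i (↑ w) | adj G i (↑ w′) | w ≟ᶠ w′
  ... | true  | true  | true  | no w≢w′ = lcm-least′ (old refl) (new refl refl w≢w′)
  ... | true  | true  | true  | yes _   = old refl
  ... | true  | true  | false | _       = old refl
  ... | true  | false | _     | _       = old refl
  ... | false | true  | true  | no w≢w′ = new refl refl w≢w′
  reduce-r-least w w′ () old new | false | true  | true  | yes _
  reduce-r-least w w′ () old new | false | true  | false | _
  reduce-r-least w w′ () old new | false | false | _     | _

  reduce-keeps-edge : ∀ w w′ → adj G (↑ w) (↑ w′) ≡ true →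
                      adj Gᵣ w w′ ≡ true × r G (↑ w) (↑ w′) ∣ r Gᵣ w w′
  reduce-keeps-edge w w′ e with adj G (↑ w) (↑ w′) | adj G i (↑ w) | adj G i (↑ w′) | w ≟ᶠ w′
  ... | true | true  | true  | no _  = refl , ∣lcmˡ (r G (↑ w) (↑ w′)) (gcd (r G i (↑ w)) (r G i (↑ w′)))
  ... | true | true  | true  | yes _ = refl , ∣-refl
  ... | true | true  | false | _     = refl , ∣-refl
  ... | true | false | _     | _     = refl , ∣-refl
  reduce-keeps-edge w w′ () | false | _ | _ | _

  reduce-adds-edge : ∀ w w′ → adj G i (↑ w) ≡ true → adj G i (↑ w′) ≡ true → w ≢ w′ →
                     adj Gᵣ w w′ ≡ true × gcd (r G i (↑ w)) (r G i (↑ w′)) ∣ r Gᵣ w w′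
  reduce-adds-edge w w′ e e′ w≢w′ with adj G (↑ w) (↑ w′) | adj G i (↑ w) | adj G i (↑ w′) | w ≟ᶠ w′
  ... | _     | _    | _    | yes w≡w′ = ⊥-elim (w≢w′ w≡w′)
  ... | true  | true | true | no _     = refl , ∣lcmʳ (r G (↑ w) (↑ w′)) (gcd (r G i (↑ w)) (r G i (↑ w′)))
  ... | false | true | true | no _     = refl , ∣-refl
  reduce-adds-edge w w′ () e′ w≢w′ | _ | false | _     | no _
  reduce-adds-edge w w′ e () w≢w′ | _ | true  | false | no _

  ψ-preserves-spline : ∀ f → IsSpline G f → IsSpline Gᵣ (ψ i f)
  ψ-preserves-spline f (m∣f , r∣f) = vertex , edge
    where
    along : ∀ {u v} → adj G u v ≡ true → f u ≡ f v mod r G u v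
    along e = congruent (∣ᵤ⇒∣ (r∣f _ _ e))
    pivot≡0 : f i ≡ 0ℤ mod m G i
    pivot≡0 = ∣⇒≡0-mod (∣ᵤ⇒∣ (m∣f i))
    vertex : ∀ w → m Gᵣ w Unsigned.∣ f (↑ w)
    vertex w = ∣⇒∣ᵤ (reduce-m-least w (∣ᵤ⇒∣ (m∣f (↑ w)))
      λ e → ≡0-mod⇒∣ (mod-sym (mod-trans-gcd (mod-sym pivot≡0) (along e))))
    edge : ∀ w w′ → adj Gᵣ w w′ ≡ true → r Gᵣ w w′ Unsigned.∣ f (↑ w) - f (↑ w′)
    edge w w′ e = ∣⇒∣ᵤ (reduce-r-least w w′ e (divides-diff ∘ along)
      λ e₁ e₂ _ → divides-diff (mod-trans-gcd (mod-sym (along e₁)) (along e₂)))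

  ψ-surjective : IsSimple G → ∀ g → IsSpline Gᵣ g →
                 ∃ λ f → IsSpline G f × (∀ w → ψ i f w ≡ g w)
  ψ-surjective simple g (m∣g , r∣g) = f , (vertex , edge) , f-punched
    where
    open IsSimple simple
    -- Non-neighbours of the pivot get the vacuous modulus 1.
    R : Fin n → ℤ
    R w = if adj G i (↑ w) then r G i (↑ w) else 1ℤ
    R-neighbour : ∀ {w} → adj G i (↑ w) ≡ true → R w ≡ r G i (↑ w)
    R-neighbour e rewrite e = refl
    compat₀ : ∀ j → 0ℤ ≡ g j mod gcd (m G i) (R j)
    compat₀ j with adj G i (↑ j) in e
    ... | true  = mod-sym (∣⇒≡0-mod (∣-trans (gcd∣reduce-m j e) (∣ᵤ⇒∣ (m∣g j))))
    ... | false = mod-weaken (gcd∣ʳ (m G i) 1ℤ) mod-one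
    compat : ∀ j l → g j ≡ g l mod gcd (R j) (R l)
    compat j l with adj G i (↑ j) in e | adj G i (↑ l) in e′ | j ≟ᶠ l
    ... | true  | true  | yes refl = mod-refl
    ... | true  | true  | no j≢l   = let adjᵣ , gcd∣r = reduce-adds-edge j l e e′ j≢l
                                    in mod-weaken gcd∣r (congruent (∣ᵤ⇒∣ (r∣g j l adjᵣ)))
    ... | true  | false | _        = mod-weaken (gcd∣ʳ (r G i (↑ j)) 1ℤ) mod-one
    ... | false | b     | _        = mod-weaken (gcd∣ˡ 1ℤ (if b then r G i (↑ l) else 1ℤ)) mod-one
    solution : ∃ λ x → x ≡ 0ℤ mod m G i × ∀ j → x ≡ g j mod R j
    solution = crt (m G i) 0ℤ R g compat₀ compat
    x : ℤ
    x = proj₁ solution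
    f : Fin (suc n) → ℤ
    f = insertAt g i x
    f-pivot : f i ≡ x
    f-pivot = insertAt-lookup g i x
    f-punched : ∀ w → f (↑ w) ≡ g w
    f-punched = insertAt-punchIn g i x
    pivot-edge : ∀ w → adj G i (↑ w) ≡ true → f i ≡ f (↑ w) mod r G i (↑ w)
    pivot-edge w e = mod-resp (sym f-pivot) (sym (f-punched w))
      (subst (x ≡ g w mod_) (R-neighbour e) (proj₂ (proj₂ solution) w))
    vertex : ∀ v → m G v Unsigned.∣ f v
    vertex v with punchView i v
    ... | pivot     = ∣⇒∣ᵤ (≡0-mod⇒∣ (mod-resp (sym f-pivot) refl (proj₁ (proj₂ solution))))
    ... | punched w = ∣⇒∣ᵤ (subst (m G (↑ w) ∣_) (sym (f-punched w)) (∣-trans (m∣reduce-m w) (∣ᵤ⇒∣ (m∣g w))))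
    edge-congruence : ∀ u v → adj G u v ≡ true → f u ≡ f v mod r G u v
    edge-congruence u v e with punchView i u | punchView i v
    ... | pivot     | pivot      with () ← trans (sym e) (adj-irrefl i)
    ... | pivot     | punched w  = pivot-edge w e
    ... | punched w | pivot      = let e′ = trans (adj-sym i (↑ w)) e
                                   in subst (f (↑ w) ≡ f i mod_) (r-sym i (↑ w) e′) (mod-sym (pivot-edge w e′))
    ... | punched w | punched w′ = let adjᵣ , r∣rᵣ = reduce-keeps-edge w w′ e
                                   in mod-resp (sym (f-punched w)) (sym (f-punched w′))
                                        (mod-weaken r∣rᵣ (congruent (∣ᵤ⇒∣ (r∣g w w′ adjᵣ))))
    edge : ∀ u v → adj G u v ≡ true → r G u v Unsigned.∣ f u - f v
    edge u v e = ∣⇒∣ᵤ (divides-diff (edge-congruence u v e))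

lemma4p2 : {n : ℕ} (G : LabeledGraph (suc n)) (i : Fin (suc n)) →
    IsSimple G → Connected G →
    ((f : Fin (suc n) → ℤ) → IsSpline G f → IsSpline (reduce G i) (ψ i f))
    × ((f g : Fin (suc n) → ℤ) (w : Fin n) →
         ψ i (λ v → f v + g v) w ≡ ψ i f w + ψ i g w)
    × ((c : ℤ) (f : Fin (suc n) → ℤ) (w : Fin n) →
         ψ i (λ v → c * f v) w ≡ c * ψ i f w)
    × ((g : Fin n → ℤ) → IsSpline (reduce G i) g →
         Σ (Fin (suc n) → ℤ) (λ f → IsSpline G f × ((w : Fin n) → ψ i f w ≡ g w)))
lemma4p2 G i simple _ =
  ψ-preserves-spline G i , (λ f g w → refl) , (λ c f w → refl) , ψ-surjective G i simple
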